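{- Let $p\ge3$ be a prime. The class $\mathcal{P}_{\mathrm{GS}(p)}$ is an obstruction to quadratic atomicity.
   Context: For $1\le i\le n$ let $H_i=\{x\in\mathbb{F}_p^n:x_1=\dots=x_i=0\}$, $e_i$ the $i$-th standard basis vector, $A_{\mathrm{GS}}(n,p)=\bigcup_{i=1}^n(H_i+e_i)$, and $\mathcal{P}_{\mathrm{GS}(p)}$ the closure of $\{(\mathbb{F}_p^n,A_{\mathrm{GS}}(n,p)):n\ge1\}$ under isomorphism (isomorphisms of pairs being bijections $f$ with $f(x+y)=f(x)-f(0)+f(y)$ preserving the distinguished sets). An elementary $p$-group property (epGP) is an isomorphism-closed class of pairs $(G,A)$ with $G$ a finite elementary abelian $p$-group, $A\subseteq G$; $\mathcal{P}_n$ is the set of its members with $G=\mathbb{F}_p^n$. A quadratic factor in $\mathbb{F}_p^n$ is $(\mathcal{L},\mathcal{Q})$, $\mathcal{L}=\{v_1,\dots,v_\ell\}\subseteq\mathbb{F}_p^n$, $\mathcal{Q}=\{M_1,\dots,M_q\}$ symmetric matrices; atoms are $\{x:x^Tv_i=r_i,\ x^TM_jx=s_j\}$; complexity $(\dim\operatorname{span}\mathcal{L},q)$; rank the minimum rank of a nontrivial combination of the $M_j$. A rank function is strictly increasing $\mathbb{N}\to\mathbb{R}^+$. An epGP $\mathcal{P}$ is quadratically atomic if for all $\epsilon>0$ and rank functions $\rho$ there are $D,N$ such that for all $n\ge N$ and $(G,A)\in\mathcal{P}$ with $|G|\ge p^n$ there is a quadratic factor in $G$ of some complexity $(\ell,q)$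 with $\ell+q\le D$ and rank at least $\rho(\ell+q)$ every atom $B$ of which satisfies $|A\cap B|/|B|\in[0,\epsilon)\cup(1-\epsilon,1]$. An epGP $\mathcal{P}$ is an obstruction to quadratic atomicity if $\mathcal{P}_n\ne\emptyset$ for arbitrarily large $n$ and for every quadratically atomic epGP $\mathcal{H}$ there is $N$ with $\mathcal{P}_n\cap\mathcal{H}_n=\emptyset$ for $n\ge N$. -}

module Defs where

open import Data.Nat using (ℕ; zero; suc; _+_; _*_; _∸_; _^_; _≤_; _<_; NonZero)
open import Data.Nat.DivMod using (_mod_)
open import Data.Fin using (Fin; toℕ) renaming (_≟_ to _≟F_)
open import Data.Bool using (Bool; true; false; _∧_; if_then_else_)
open import Data.Vec using (Vec; []; _∷_; lookup; tabulate; zipWith; foldr; replicate; map)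
open import Data.List using (List; [_]; concatMap; allFin; length; filter)
open import Data.Bool.ListAction using (all; any)
import Data.List as L
open import Data.Product using (Σ; ∃; _×_; _,_)
open import Data.Sum using (_⊎_)
open import Relation.Nullary using (¬_; does)
open import Relation.Nullary.Decidable using (⌊_⌋)
open import Relation.Binary.PropositionalEquality using (_≡_)
open import Level using () renaming (suc to lsuc; zero to lzero)

module _ (p : ℕ) .{{nz : NonZero p}} where

  F : Set
  F = Fin p

  0F 1F : F
  0F = 0 mod p
  1F = 1 mod p

  _+F_ _*F_ _-F_ : F → F → F
  a +F b = (toℕ a + toℕ b) mod p
  a *F b = (toℕ a * toℕ b) mod p
  a -F b = (toℕ a + (p ∸ toℕ b)) mod p

  _==F_ : F → F → Bool
  a ==F b = ⌊ a ≟F b ⌋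

  V : ℕ → Set
  V n = Vec F n

  0V : (n : ℕ) → V n
  0V n = replicate n 0F

  _+V_ _-V_ : {n : ℕ} → V n → V n → V n
  x +V y = zipWith _+F_ x y
  x -V y = zipWith _-F_ x y

  _•V_ : {n : ℕ} → F → V n → V n
  c •V x = map (c *F_) x

  -- standard basis vector e_i (0-based index i stands for e_{i+1})
  e : (n : ℕ) → Fin n → V n
  e n i = tabulate (λ j → if ⌊ j ≟F i ⌋ then 1F else 0F)

  dot : {n : ℕ} → V n → V n → F
  dot x v = foldr _ _+F_ 0F (zipWith _*F_ x v)

  Mat : ℕ → Set
  Mat n = Vec (V n) n

  Symmetric : {n : ℕ} → Mat n → Set
  Symmetric M = ∀ i j → lookup (lookup M i) j ≡ lookup (lookup M j) i

  matVec : {n : ℕ} → Mat n → V n → V n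
  matVec M x = map (λ row → dot row x) M

  quadForm : {n : ℕ} → Mat n → V n → F
  quadForm M x = dot x (matVec M x)

  0M : (n : ℕ) → Mat n
  0M n = replicate n (0V n)

  _+M_ : {n : ℕ} → Mat n → Mat n → Mat n
  M +M N = zipWith _+V_ M N

  _•M_ : {n : ℕ} → F → Mat n → Mat n
  c •M M = map (c •V_) M

  linComb : {n k : ℕ} → Vec F k → Vec (V n) k → V n
  linComb {n} [] [] = 0V n
  linComb (c ∷ cs) (w ∷ ws) = (c •V w) +V linComb cs ws

  linCombM : {n k : ℕ} → Vec F k → Vec (Mat n) k → Mat n
  linCombM {n} [] [] = 0M n
  linCombM (c ∷ cs) (M ∷ Ms) = (c •M M) +M linCombM cs Ms

  LinIndep : {n k : ℕ} → Vec (V n) k → Set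
  LinIndep {n} {k} ws = (c : Vec F k) → linComb c ws ≡ 0V n → c ≡ replicate k 0F

  InSpan : {n k : ℕ} → V n → Vec (V n) k → Set
  InSpan {n} {k} w ws = Σ (Vec F k) λ c → linComb c ws ≡ w

  HasDimSpan : {n ℓ : ℕ} → Vec (V n) ℓ → ℕ → Set
  HasDimSpan {n} {ℓ} vs d =
    Σ (Vec (Fin ℓ) d) λ idx →
      LinIndep (map (lookup vs) idx) × (∀ i → InSpan (lookup vs i) (map (lookup vs) idx))

  RankAtLeast : {n : ℕ} → Mat n → ℕ → Set
  RankAtLeast {n} M r = Σ (Vec (Fin n) r) λ idx → LinIndep (map (lookup M) idx)

  Subset : ℕ → Set
  Subset n = V n → Bool

  allVecs : (n : ℕ) → List (V n)
  allVecs zero = [ [] ]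
  allVecs (suc n) = concatMap (λ a → L.map (a ∷_) (allVecs n)) (allFin p)

  count : {n : ℕ} → Subset n → ℕ
  count {n} A = length (filter (λ x → A x Data.Bool.≟ true) (allVecs n))

  IsIsoMap : {n : ℕ} → (V n → V n) → Set
  IsIsoMap {n} f =
    (∀ x y → f (x +V y) ≡ (f x -V f (0V n)) +V f y) ×
    Σ (V n → V n) λ g → (∀ x → g (f x) ≡ x) × (∀ y → f (g y) ≡ y)

  PairIso : {n : ℕ} → Subset n → Subset n → Set
  PairIso {n} A B = Σ (V n → V n) λ f → IsIsoMap f × (∀ x → B (f x) ≡ A x)

  -- Every finite elementary abelian
  -- p-group is isomorphic to some F_p^n, so an epGP is determined by
  -- the family of its slices P_n, which must be isomorphism closed.

  Class : Set₁
  Class = (n : ℕ) → Subset n → Set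

  IsEpGP : Class → Set
  IsEpGP P = ∀ n (A B : Subset n) → PairIso A B → P n A → P n B

  -- y ∈ H_{i+1}  (coordinates 0..i, i.e. x_1..x_{i+1}, vanish)
  inH : {n : ℕ} → Fin n → V n → Bool
  inH {n} i y = all (λ j → if ⌊ Data.Nat._≤?_ (toℕ j) (toℕ i) ⌋ then lookup y j ==F 0F else true) (allFin n)

  AGS : (n : ℕ) → Subset n
  AGS n x = any (λ i → inH i (x -V e n i)) (allFin n)

  PGS : Class
  PGS n A = (1 ≤ n) × PairIso (AGS n) A

  record QuadFactor (n : ℕ) : Set where
    field
      ℓ : ℕ
      vs : Vec (V n) ℓ
      q : ℕ
      Ms : Vec (Mat n) q
      sym : ∀ j → Symmetric (lookup Ms j)

  open QuadFactor public

  allTrue : {k : ℕ} → Vec Bool k → Bool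
  allTrue = foldr _ _∧_ true

  atom : {n : ℕ} (Φ : QuadFactor n) → Vec F (ℓ Φ) → Vec F (q Φ) → Subset n
  atom Φ r s x =
    allTrue (zipWith (λ v ri → dot x v ==F ri) (vs Φ) r) ∧
    allTrue (zipWith (λ M sj → quadForm M x ==F sj) (Ms Φ) s)

  FactorRankAtLeast : {n : ℕ} → QuadFactor n → ℕ → Set
  FactorRankAtLeast Φ R =
    (c : Vec F (q Φ)) → ¬ (c ≡ replicate (q Φ) 0F) → RankAtLeast (linCombM c (Ms Φ)) R

  -- ε = a / b with a, b > 0 given as (suc a') / (suc b').
  -- |A∩B|/|B| ∈ [0,ε) ∪ (1-ε,1], for a nonempty atom B.
  EpsExtreme : {n : ℕ} → ℕ → ℕ → Subset n → Subset n → Set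
  EpsExtreme a' b' A B =
    let nB = count B
        nAB = count (λ x → A x ∧ B x)
    in (nAB * suc b' < suc a' * nB) ⊎ ((nB ∸ nAB) * suc b' < suc a' * nB)

  -- rank functions, taken ℕ-valued
  IsRankFunction : (ℕ → ℕ) → Set
  IsRankFunction ρ = (0 < ρ 0) × (∀ k → ρ k < ρ (suc k))

  IsQuadAtomic : Class → Set
  IsQuadAtomic P =
    (a' b' : ℕ) (ρ : ℕ → ℕ) → IsRankFunction ρ →
    Σ ℕ λ D → Σ ℕ λ N →
      (m : ℕ) → N ≤ m → (A : Subset m) → P m A →
      Σ (QuadFactor m) λ Φ → Σ ℕ λ d →
        HasDimSpan (vs Φ) d × (d + q Φ ≤ D) × FactorRankAtLeast Φ (ρ (d + q Φ)) ×
        ((r : Vec F (ℓ Φ)) (s : Vec F (q Φ)) → 0 < count (atom Φ r s) →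
           EpsExtreme a' b' A (atom Φ r s))

  IsObstructionToQA : Class → Set₁
  IsObstructionToQA P =
    ((N : ℕ) → Σ ℕ λ n → (N ≤ n) × Σ (Subset n) λ A → P n A) ×
    ((H : Class) → IsEpGP H → IsQuadAtomic H →
       Σ ℕ λ N → (n : ℕ) → N ≤ n → (A : Subset n) → P n A → ¬ H n A)

{-# OPTIONS --safe #-}
module Submission where

-- Let H be quadratically atomic and contain a copy of A = A_GS(n,p) with n large; being
-- isomorphism closed, H contains A itself.  Take ε = 1/(2p+1).  The factor provided for A has
-- fewer than n independent linear forms, so some x ≠ 0 is orthogonal to all of them; let B be
-- the atom of x.  For c ≠ 0 the atom of c·x is the dilate c·B, so it has |B| elements, and it
-- is symmetric under y ↦ -y.  As p is odd, A ∩ -A = ∅, so A fills at most half of c·B and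
-- extremality forces |A ∩ c·B| < |B|/(2p+1).  But A is the set of vectors whose first nonzero
-- coordinate is 1, so every y ≠ 0 in B lies in c⁻¹·(A ∩ c·B) for some c; hence
-- |B| ≤ 2 Σ_c |A ∩ c·B| < 2p|B|/(2p+1) < |B|.

open import Defs hiding (sym)

open import Algebra.Bundles using (CommutativeRing)
open import Algebra.Consequences.Propositional
  using (comm∧assoc⇒middleFour; comm∧idˡ⇒id; comm∧invʳ⇒inv; comm∧distrˡ⇒distrʳ)
open import Algebra.Definitions using (Associative; Commutative; LeftIdentity; RightInverse; _DistributesOverˡ_)
open import Data.Bool using (Bool; true; false; if_then_else_; _∧_; _∨_)
import Data.Bool as Bool
open import Data.Bool.ListAction using (and; or; all; any)
open import Data.Bool.Properties using (∧-identityʳ; ∧-zeroʳ)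
open import Data.Empty using (⊥-elim)
open import Data.Fin using (Fin; toℕ; zero; suc) renaming (_≟_ to _≟F_)
open import Data.Fin.Properties using (suc-injective; toℕ-injective; toℕ-fromℕ<; toℕ<n)
open import Data.List using (List; []; _∷_; _++_; length; concatMap; allFin)
import Data.List as List
open import Data.List.Membership.Propositional using (find)
open import Data.List.Membership.Propositional.Properties using (∈-∃++)
open import Data.List.Properties using (map-tabulate; map-cong; length-map; length-++-sucʳ; length-tabulate)
open import Data.List.Relation.Unary.All as All using (All)
import Data.List.Relation.Unary.All.Properties as Allₚ
open import Data.Nat
  using (ℕ; zero; suc; _+_; _*_; _∸_; _%_; _≤_; _<_; z≤n; s≤s; s≤s⁻¹; z<s; NonZero
        ; >-nonZero; >-nonZero⁻¹; ≢-nonZero; nonTrivial⇒n>1)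
open import Data.Nat.Coprimality using (prime⇒coprime; coprime-Bézout)
open import Data.Nat.DivMod using (_mod_; m%n<n; m%n%n≡m%n; %-distribˡ-+; %-distribˡ-*; m<n⇒m%n≡m; n%n≡0)
open import Data.Nat.GCD using (module Bézout)
open import Data.Nat.Primality using (Prime; prime⇒nonZero; prime⇒nonTrivial)
import Data.Nat.Properties as ℕ
open import Data.Nat.Solver using (module +-*-Solver)
open import Data.Product using (_,_; ∃; _×_; proj₁; proj₂)
open import Data.Sum using (inj₁; inj₂)
open import Data.Vec using (Vec; []; _∷_; lookup; head; zipWith)
import Data.Vec as Vec
open import Data.Vec.Properties using (≡-dec; ∷-injectiveˡ; ∷-injectiveʳ)
import Data.Vec.Properties as Vecₚ
import Data.Vec.Relation.Unary.All.Properties as VecAllₚ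
open import Function using (_∘_; id)
open import Function.Bundles using (_⇔_; mk⇔)
open import Relation.Binary.Definitions using (DecidableEquality)
open import Relation.Binary.PropositionalEquality
open import Relation.Nullary using (¬_; does; yes; no)
open import Relation.Nullary.Decidable using (Dec; ⌊_⌋; does-⇔; isYes≗does; dec-true; dec-false)

module Sums where

  private
    variable
      A B : Set

  ∑ : List A → (A → ℕ) → ℕ
  ∑ []       h = 0
  ∑ (x ∷ xs) h = h x + ∑ xs h

  ∑-cong : ∀ (xs : List A) {h g : A → ℕ} → (∀ x → h x ≡ g x) → ∑ xs h ≡ ∑ xs g
  ∑-cong []       h≗g = refl
  ∑-cong (x ∷ xs) h≗g = cong₂ _+_ (h≗g x) (∑-cong xs h≗g)

  ∑-mono-≤ : ∀ (xs : List A) {h g : A → ℕ} → (∀ x → h x ≤ g x) → ∑ xs h ≤ ∑ xs g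
  ∑-mono-≤ []       h≤g = z≤n
  ∑-mono-≤ (x ∷ xs) h≤g = ℕ.+-mono-≤ (h≤g x) (∑-mono-≤ xs h≤g)

  ∑-zero : ∀ (xs : List A) → ∑ xs (λ _ → 0) ≡ 0
  ∑-zero []       = refl
  ∑-zero (x ∷ xs) = ∑-zero xs

  ∑-const : ∀ (xs : List A) c → ∑ xs (λ _ → c) ≡ length xs * c
  ∑-const []       c = refl
  ∑-const (x ∷ xs) c = cong (c +_) (∑-const xs c)

  ∑-distrib-+ : ∀ (xs : List A) (h g : A → ℕ) → ∑ xs (λ x → h x + g x) ≡ ∑ xs h + ∑ xs g
  ∑-distrib-+ []       h g = refl
  ∑-distrib-+ (x ∷ xs) h g = trans (cong (h x + g x +_) (∑-distrib-+ xs h g))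
                                   (comm∧assoc⇒middleFour ℕ.+-comm ℕ.+-assoc (h x) (g x) _ _)

  ∑-distribʳ-* : ∀ (xs : List A) (h : A → ℕ) k → ∑ xs (λ x → h x * k) ≡ ∑ xs h * k
  ∑-distribʳ-* []       h k = refl
  ∑-distribʳ-* (x ∷ xs) h k = trans (cong (h x * k +_) (∑-distribʳ-* xs h k)) (sym (ℕ.*-distribʳ-+ k (h x) _))

  ∑-++ : ∀ (xs ys : List A) h → ∑ (xs ++ ys) h ≡ ∑ xs h + ∑ ys h
  ∑-++ []       ys h = refl
  ∑-++ (x ∷ xs) ys h = trans (cong (h x +_) (∑-++ xs ys h)) (sym (ℕ.+-assoc (h x) _ _))

  ∑-map : ∀ (f : A → B) (xs : List A) h → ∑ (List.map f xs) h ≡ ∑ xs (h ∘ f)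
  ∑-map f []       h = refl
  ∑-map f (x ∷ xs) h = cong (h (f x) +_) (∑-map f xs h)

  ∑-concatMap : ∀ (f : A → List B) (xs : List A) h → ∑ (concatMap f xs) h ≡ ∑ xs (λ x → ∑ (f x) h)
  ∑-concatMap f []       h = refl
  ∑-concatMap f (x ∷ xs) h = trans (∑-++ (f x) (concatMap f xs) h) (cong (∑ (f x) h +_) (∑-concatMap f xs h))

  ∑-comm : ∀ (xs : List A) (ys : List B) (h : A → B → ℕ) →
           ∑ xs (λ x → ∑ ys (h x)) ≡ ∑ ys (λ y → ∑ xs (λ x → h x y))
  ∑-comm []       ys h = sym (∑-zero ys)
  ∑-comm (x ∷ xs) ys h = trans (cong (∑ ys (h x) +_) (∑-comm xs ys h))
                               (sym (∑-distrib-+ ys (h x) (λ y → ∑ xs (λ x′ → h x′ y))))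

  ∑-tabulate : ∀ m (f : Fin m → A) h → ∑ (List.tabulate f) h ≡ ∑ (allFin m) (h ∘ f)
  ∑-tabulate zero    f h = refl
  ∑-tabulate (suc m) f h = cong (h (f zero) +_) (trans (∑-tabulate m (f ∘ suc) h) (sym (∑-tabulate m suc (h ∘ f))))

  if-then-0-≤ : ∀ b {k} → (if b then k else 0) ≤ k
  if-then-0-≤ true  = ℕ.≤-refl
  if-then-0-≤ false = z≤n

  ∑-δ-Fin : ∀ m (b : Fin m) (k : Fin m → ℕ) → ∑ (allFin m) (λ a → if does (b ≟F a) then k a else 0) ≡ k b
  ∑-δ-Fin (suc m) zero    k = begin
    k zero + ∑ (List.tabulate suc) (λ a → if does (zero ≟F a) then k a else 0)  ≡⟨ cong (k zero +_) (∑-tabulate m suc _) ⟩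
    k zero + ∑ (allFin m) (λ _ → 0)                                              ≡⟨ cong (k zero +_) (∑-zero (allFin m)) ⟩
    k zero + 0                                                                    ≡⟨ ℕ.+-identityʳ (k zero) ⟩
    k zero                                                                        ∎
    where open ≡-Reasoning
  ∑-δ-Fin (suc m) (suc b) k = trans (∑-tabulate m suc _) (∑-δ-Fin m b (k ∘ suc))

  term≤∑-allFin : ∀ m (b : Fin m) (k : Fin m → ℕ) → k b ≤ ∑ (allFin m) k
  term≤∑-allFin m b k = subst (_≤ ∑ (allFin m) k) (∑-δ-Fin m b k) (∑-mono-≤ (allFin m) (λ a → if-then-0-≤ (does (b ≟F a))))

⌊⌋-⇔ : ∀ {A B : Set} → A ⇔ B → (a? : Dec A) (b? : Dec B) → ⌊ a? ⌋ ≡ ⌊ b? ⌋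
⌊⌋-⇔ A⇔B a? b? = trans (isYes≗does a?) (trans (does-⇔ A⇔B a? b?) (sym (isYes≗does b?)))

all-allFin-suc : ∀ {n} (f : Fin (suc n) → Bool) → all f (allFin (suc n)) ≡ f zero ∧ all (f ∘ suc) (allFin n)
all-allFin-suc {n} f = cong (λ bs → f zero ∧ and bs) (trans (map-tabulate suc f) (sym (map-tabulate id (f ∘ suc))))

any-allFin-suc : ∀ {n} (f : Fin (suc n) → Bool) → any f (allFin (suc n)) ≡ f zero ∨ any (f ∘ suc) (allFin n)
any-allFin-suc {n} f = cong (λ bs → f zero ∨ or bs) (trans (map-tabulate suc f) (sym (map-tabulate id (f ∘ suc))))

all-cong : ∀ {A : Set} {f g : A → Bool} → (∀ x → f x ≡ g x) → ∀ xs → all f xs ≡ all g xs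
all-cong f≗g xs = cong and (map-cong f≗g xs)

any-cong : ∀ {A : Set} {f g : A → Bool} → (∀ x → f x ≡ g x) → ∀ xs → any f xs ≡ any g xs
any-cong f≗g xs = cong or (map-cong f≗g xs)

all-true : ∀ {A : Set} (xs : List A) → all (λ _ → true) xs ≡ true
all-true []       = refl
all-true (x ∷ xs) = all-true xs

any-∧ˡ : ∀ {A : Set} b (f : A → Bool) xs → any (λ x → b ∧ f x) xs ≡ b ∧ any f xs
any-∧ˡ false f xs       = any-false xs
  where
  any-false : ∀ xs → any (λ _ → false) xs ≡ false
  any-false []       = refl
  any-false (x ∷ xs) = any-false xs
any-∧ˡ true  f []       = refl
any-∧ˡ true  f (x ∷ xs) = cong (f x ∨_) (any-∧ˡ true f xs)

m+m≤n⇒n≤[n∸m]*suc[o] : ∀ m n o → 1 ≤ o → m + m ≤ n → n ≤ (n ∸ m) * suc o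
m+m≤n⇒n≤[n∸m]*suc[o] m n o 1≤o m+m≤n = begin
  n                          ≡⟨ sym (ℕ.m+[n∸m]≡n (ℕ.m+n≤o⇒m≤o m m+m≤n)) ⟩
  m + (n ∸ m)                ≤⟨ ℕ.+-monoˡ-≤ (n ∸ m) (ℕ.m+n≤o⇒m≤o∸n m m+m≤n) ⟩
  (n ∸ m) + (n ∸ m)          ≤⟨ ℕ.+-monoʳ-≤ (n ∸ m) (ℕ.m≤m*n (n ∸ m) o) ⟩
  (n ∸ m) + (n ∸ m) * o      ≡⟨ sym (ℕ.*-suc (n ∸ m) o) ⟩
  (n ∸ m) * suc o            ∎
  where
  open ℕ.≤-Reasoning
  instance
    o≢0 : NonZero o
    o≢0 = >-nonZero 1≤o

0<m≤n+n⇒o*m<n*suc[2o] : ∀ m n o → 0 < m → m ≤ n + n → o * m < n * suc (2 * o)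
0<m≤n+n⇒o*m<n*suc[2o] m n o 0<m m≤n+n = ℕ.≰⇒> (λ n*k≤o*m → ℕ.<⇒≱ 2om<2nk (ℕ.+-mono-≤ n*k≤o*m n*k≤o*m))
  where
  open ℕ.≤-Reasoning
  open +-*-Solver
  2om<2nk : o * m + o * m < n * suc (2 * o) + n * suc (2 * o)
  2om<2nk = begin-strict
    o * m + o * m                        <⟨ ℕ.m<n+m (o * m + o * m) 0<m ⟩
    m + (o * m + o * m)                  ≡⟨ solve 2 (λ m o → m :+ (o :* m :+ o :* m) := m :* (con 1 :+ con 2 :* o)) refl m o ⟩
    m * suc (2 * o)                      ≤⟨ ℕ.*-monoˡ-≤ (suc (2 * o)) m≤n+n ⟩
    (n + n) * suc (2 * o)                ≡⟨ ℕ.*-distribʳ-+ (suc (2 * o)) n n ⟩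
    n * suc (2 * o) + n * suc (2 * o)    ∎

module ZMod (p : ℕ) .{{_ : NonZero p}} where

  open Sums

  𝔽 : Set
  𝔽 = F p

  infixl 6 _⊕_ _⊖_
  infixl 7 _⊛_
  infix 8 ⊝_
  _⊕_ _⊛_ _⊖_ : 𝔽 → 𝔽 → 𝔽
  _⊕_ = _+F_ p
  _⊛_ = _*F_ p
  _⊖_ = _-F_ p

  𝟘 𝟙 : 𝔽
  𝟘 = 0F p
  𝟙 = 1F p

  infix 4 _==_
  _==_ : 𝔽 → 𝔽 → Bool
  _==_ = _==F_ p

  ==-true : ∀ a b → a ≡ b → (a == b) ≡ true
  ==-true a b a≡b = trans (isYes≗does (a ≟F b)) (dec-true (a ≟F b) a≡b)

  ==-false : ∀ a b → a ≢ b → (a == b) ≡ false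
  ==-false a b a≢b = trans (isYes≗does (a ≟F b)) (dec-false (a ≟F b) a≢b)

  ⊝_ : 𝔽 → 𝔽
  ⊝ a = 𝟘 ⊖ a

  -- Reduction mod p is a surjective semiring morphism ℕ → 𝔽, so the ring
  -- laws of 𝔽 are transported from those of ℕ.
  ι : ℕ → 𝔽
  ι m = m mod p

  toℕ-ι : ∀ m → toℕ (ι m) ≡ m % p
  toℕ-ι m = toℕ-fromℕ< (m%n<n m p)

  ι-toℕ : ∀ a → ι (toℕ a) ≡ a
  ι-toℕ a = toℕ-injective (trans (toℕ-ι (toℕ a)) (m<n⇒m%n≡m (toℕ<n a)))

  ι-% : ∀ m → ι (m % p) ≡ ι m
  ι-% m = toℕ-injective (trans (toℕ-ι (m % p)) (trans (m%n%n≡m%n m p) (sym (toℕ-ι m))))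

  ι-+ : ∀ m n → ι (m + n) ≡ ι m ⊕ ι n
  ι-+ m n = begin
    ι (m + n)                  ≡⟨ sym (ι-% (m + n)) ⟩
    ι ((m + n) % p)            ≡⟨ cong ι (%-distribˡ-+ m n p) ⟩
    ι ((m % p + n % p) % p)    ≡⟨ ι-% _ ⟩
    ι (m % p + n % p)          ≡⟨ sym (cong₂ (λ a b → ι (a + b)) (toℕ-ι m) (toℕ-ι n)) ⟩
    ι m ⊕ ι n                  ∎
    where open ≡-Reasoning

  ι-* : ∀ m n → ι (m * n) ≡ ι m ⊛ ι n
  ι-* m n = begin
    ι (m * n)                  ≡⟨ sym (ι-% (m * n)) ⟩
    ι ((m * n) % p)            ≡⟨ cong ι (%-distribˡ-* m n p) ⟩
    ι ((m % p * (n % p)) % p)  ≡⟨ ι-% _ ⟩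
    ι (m % p * (n % p))        ≡⟨ sym (cong₂ (λ a b → ι (a * b)) (toℕ-ι m) (toℕ-ι n)) ⟩
    ι m ⊛ ι n                  ∎
    where open ≡-Reasoning

  ι-*-toℕ : ∀ m a → ι (m * toℕ a) ≡ ι m ⊛ a
  ι-*-toℕ m a = trans (ι-* m (toℕ a)) (cong (ι m ⊛_) (ι-toℕ a))

  ι-p : ι p ≡ 𝟘
  ι-p = trans (sym (ι-% p)) (cong ι (n%n≡0 p))

  toℕ-𝟘 : toℕ 𝟘 ≡ 0
  toℕ-𝟘 = trans (toℕ-ι 0) (m<n⇒m%n≡m (>-nonZero⁻¹ p))

  ⊝-ι : ∀ a → ⊝ a ≡ ι (p ∸ toℕ a)
  ⊝-ι a = cong (λ z → ι (z + (p ∸ toℕ a))) toℕ-𝟘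

  ⊖-⊕⊝ : ∀ a b → a ⊖ b ≡ a ⊕ ⊝ b
  ⊖-⊕⊝ a b = trans (ι-+ (toℕ a) (p ∸ toℕ b)) (cong₂ _⊕_ (ι-toℕ a) (sym (⊝-ι b)))

  ι-transports-assoc : (_∙_ : ℕ → ℕ → ℕ) (_∘_ : 𝔽 → 𝔽 → 𝔽) →
                       (∀ a b → a ∘ b ≡ ι (toℕ a ∙ toℕ b)) → (∀ m n → ι (m ∙ n) ≡ ι m ∘ ι n) →
                       Associative _≡_ _∙_ → Associative _≡_ _∘_
  ι-transports-assoc _∙_ _∘_ ∘-def ι-∙ ∙-assoc a b c = begin
    (a ∘ b) ∘ c                      ≡⟨ cong₂ _∘_ (∘-def a b) (sym (ι-toℕ c)) ⟩
    ι (toℕ a ∙ toℕ b) ∘ ι (toℕ c)    ≡⟨ sym (ι-∙ _ _) ⟩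
    ι ((toℕ a ∙ toℕ b) ∙ toℕ c)      ≡⟨ cong ι (∙-assoc (toℕ a) (toℕ b) (toℕ c)) ⟩
    ι (toℕ a ∙ (toℕ b ∙ toℕ c))      ≡⟨ ι-∙ _ _ ⟩
    ι (toℕ a) ∘ ι (toℕ b ∙ toℕ c)    ≡⟨ cong₂ _∘_ (ι-toℕ a) (sym (∘-def b c)) ⟩
    a ∘ (b ∘ c)                      ∎
    where open ≡-Reasoning

  ⊕-assoc : Associative _≡_ _⊕_
  ⊕-assoc = ι-transports-assoc _+_ _⊕_ (λ _ _ → refl) ι-+ ℕ.+-assoc

  ⊛-assoc : Associative _≡_ _⊛_
  ⊛-assoc = ι-transports-assoc _*_ _⊛_ (λ _ _ → refl) ι-* ℕ.*-assoc

  ⊕-comm : Commutative _≡_ _⊕_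
  ⊕-comm a b = cong ι (ℕ.+-comm (toℕ a) (toℕ b))

  ⊛-comm : Commutative _≡_ _⊛_
  ⊛-comm a b = cong ι (ℕ.*-comm (toℕ a) (toℕ b))

  ⊕-identityˡ : LeftIdentity _≡_ 𝟘 _⊕_
  ⊕-identityˡ a = trans (cong (𝟘 ⊕_) (sym (ι-toℕ a))) (trans (sym (ι-+ 0 (toℕ a))) (ι-toℕ a))

  ⊛-identityˡ : LeftIdentity _≡_ 𝟙 _⊛_
  ⊛-identityˡ a = begin
    𝟙 ⊛ a              ≡⟨ cong (𝟙 ⊛_) (sym (ι-toℕ a)) ⟩
    ι 1 ⊛ ι (toℕ a)    ≡⟨ sym (ι-* 1 (toℕ a)) ⟩
    ι (1 * toℕ a)      ≡⟨ cong ι (ℕ.*-identityˡ (toℕ a)) ⟩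
    ι (toℕ a)          ≡⟨ ι-toℕ a ⟩
    a                  ∎
    where open ≡-Reasoning

  ⊛-distribˡ-⊕ : _DistributesOverˡ_ _≡_ _⊛_ _⊕_
  ⊛-distribˡ-⊕ a b c = begin
    a ⊛ (b ⊕ c)                             ≡⟨ cong (_⊛ (b ⊕ c)) (sym (ι-toℕ a)) ⟩
    ι (toℕ a) ⊛ ι (toℕ b + toℕ c)           ≡⟨ sym (ι-* (toℕ a) _) ⟩
    ι (toℕ a * (toℕ b + toℕ c))             ≡⟨ cong ι (ℕ.*-distribˡ-+ (toℕ a) (toℕ b) (toℕ c)) ⟩
    ι (toℕ a * toℕ b + toℕ a * toℕ c)       ≡⟨ ι-+ _ _ ⟩
    a ⊛ b ⊕ a ⊛ c                           ∎
    where open ≡-Reasoning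

  ⊝-inverseʳ : RightInverse _≡_ 𝟘 ⊝_ _⊕_
  ⊝-inverseʳ a = begin
    a ⊕ ⊝ a                            ≡⟨ cong₂ _⊕_ (sym (ι-toℕ a)) (⊝-ι a) ⟩
    ι (toℕ a) ⊕ ι (p ∸ toℕ a)          ≡⟨ sym (ι-+ (toℕ a) _) ⟩
    ι (toℕ a + (p ∸ toℕ a))            ≡⟨ cong ι (ℕ.m+[n∸m]≡n (ℕ.<⇒≤ (toℕ<n a))) ⟩
    ι p                                ≡⟨ ι-p ⟩
    𝟘                                  ∎
    where open ≡-Reasoning

  commutativeRing : CommutativeRing _ _
  commutativeRing = record
    { Carrier = 𝔽 ; _≈_ = _≡_ ; _+_ = _⊕_ ; _*_ = _⊛_ ; -_ = ⊝_ ; 0# = 𝟘 ; 1# = 𝟙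
    ; isCommutativeRing = record
      { isRing = record
        { +-isAbelianGroup = record
          { isGroup = record
            { isMonoid = record
              { isSemigroup = record
                { isMagma = record { isEquivalence = isEquivalence ; ∙-cong = cong₂ _⊕_ }
                ; assoc = ⊕-assoc }
              ; identity = comm∧idˡ⇒id ⊕-comm ⊕-identityˡ }
            ; inverse = comm∧invʳ⇒inv ⊕-comm ⊝-inverseʳ
            ; ⁻¹-cong = cong ⊝_ }
          ; comm = ⊕-comm }
        ; *-cong = cong₂ _⊛_
        ; *-assoc = ⊛-assoc
        ; *-identity = comm∧idˡ⇒id ⊛-comm ⊛-identityˡ
        ; distrib = ⊛-distribˡ-⊕ , comm∧distrˡ⇒distrʳ ⊛-comm ⊛-distribˡ-⊕ }
      ; *-comm = ⊛-comm } }

  open CommutativeRing commutativeRing public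
    using (+-identityʳ; *-identityʳ; zeroˡ; zeroʳ; +-assoc; -‿inverseˡ; commutativeSemiring)
  open import Algebra.Properties.Ring (CommutativeRing.ring commutativeRing) public
    using (-‿distribˡ-*; -1*x≈-x)
  open import Algebra.Properties.Group (CommutativeRing.+-group commutativeRing) public
    using (⁻¹-involutive; ε⁻¹≈ε; x∙y⁻¹≈ε⇒x≈y; inverseʳ-unique)
  open import Algebra.Solver.Ring.NaturalCoefficients.Default commutativeSemiring public

  ⊖-identityʳ : ∀ a → a ⊖ 𝟘 ≡ a
  ⊖-identityʳ a = trans (⊖-⊕⊝ a 𝟘) (trans (cong (a ⊕_) ε⁻¹≈ε) (+-identityʳ a))

  ⊖-⊕-cancel : ∀ a b → a ⊖ b ⊕ b ≡ a
  ⊖-⊕-cancel a b = begin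
    a ⊖ b ⊕ b        ≡⟨ cong (_⊕ b) (⊖-⊕⊝ a b) ⟩
    a ⊕ ⊝ b ⊕ b      ≡⟨ +-assoc a (⊝ b) b ⟩
    a ⊕ (⊝ b ⊕ b)    ≡⟨ cong (a ⊕_) (-‿inverseˡ b) ⟩
    a ⊕ 𝟘            ≡⟨ +-identityʳ a ⟩
    a                ∎
    where open ≡-Reasoning

  ⊖≡𝟘⇔≡ : ∀ a b → (a ⊖ b ≡ 𝟘) ⇔ (a ≡ b)
  ⊖≡𝟘⇔≡ a b = mk⇔ (λ eq → x∙y⁻¹≈ε⇒x≈y a b (trans (sym (⊖-⊕⊝ a b)) eq))
                   (λ { refl → trans (⊖-⊕⊝ a a) (⊝-inverseʳ a) })

  ι[m+k*p]≡ι[m] : ∀ m k → ι (m + k * p) ≡ ι m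
  ι[m+k*p]≡ι[m] m k = begin
    ι (m + k * p)        ≡⟨ ι-+ m (k * p) ⟩
    ι m ⊕ ι (k * p)      ≡⟨ cong (ι m ⊕_) (trans (ι-* k p) (cong (ι k ⊛_) ι-p)) ⟩
    ι m ⊕ ι k ⊛ 𝟘        ≡⟨ cong (ι m ⊕_) (zeroʳ (ι k)) ⟩
    ι m ⊕ 𝟘              ≡⟨ +-identityʳ (ι m) ⟩
    ι m                  ∎
    where open ≡-Reasoning

  Vec𝔽 : ℕ → Set
  Vec𝔽 = V p

  infixl 6 _⊞_ _⊟_
  infixr 7 _⊙_
  _⊞_ _⊟_ : ∀ {n} → Vec𝔽 n → Vec𝔽 n → Vec𝔽 n
  _⊞_ = _+V_ p
  _⊟_ = _-V_ p

  _⊙_ : ∀ {n} → 𝔽 → Vec𝔽 n → Vec𝔽 n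
  _⊙_ = _•V_ p

  𝟎 : ∀ n → Vec𝔽 n
  𝟎 = 0V p

  ⟨_,_⟩ : ∀ {n} → Vec𝔽 n → Vec𝔽 n → 𝔽
  ⟨_,_⟩ = dot p

  ⊞-identityʳ : ∀ {n} (x : Vec𝔽 n) → x ⊞ 𝟎 n ≡ x
  ⊞-identityʳ []      = refl
  ⊞-identityʳ (a ∷ x) = cong₂ _∷_ (+-identityʳ a) (⊞-identityʳ x)

  ⊟-identityʳ : ∀ {n} (x : Vec𝔽 n) → x ⊟ 𝟎 n ≡ x
  ⊟-identityʳ []      = refl
  ⊟-identityʳ (a ∷ x) = cong₂ _∷_ (⊖-identityʳ a) (⊟-identityʳ x)

  ⊟-⊞-cancel : ∀ {n} (x y : Vec𝔽 n) → x ⊟ y ⊞ y ≡ x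
  ⊟-⊞-cancel []      []      = refl
  ⊟-⊞-cancel (a ∷ x) (b ∷ y) = cong₂ _∷_ (⊖-⊕-cancel a b) (⊟-⊞-cancel x y)

  ⊙-assoc : ∀ {n} c d (x : Vec𝔽 n) → c ⊙ d ⊙ x ≡ (c ⊛ d) ⊙ x
  ⊙-assoc c d []      = refl
  ⊙-assoc c d (a ∷ x) = cong₂ _∷_ (sym (⊛-assoc c d a)) (⊙-assoc c d x)

  ⊙-identityˡ : ∀ {n} (x : Vec𝔽 n) → 𝟙 ⊙ x ≡ x
  ⊙-identityˡ []      = refl
  ⊙-identityˡ (a ∷ x) = cong₂ _∷_ (⊛-identityˡ a) (⊙-identityˡ x)

  ⊙-zeroˡ : ∀ {n} (x : Vec𝔽 n) → 𝟘 ⊙ x ≡ 𝟎 n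
  ⊙-zeroˡ []      = refl
  ⊙-zeroˡ (a ∷ x) = cong₂ _∷_ (zeroˡ a) (⊙-zeroˡ x)

  dot-𝟎ˡ : ∀ {n} (x : Vec𝔽 n) → ⟨ 𝟎 n , x ⟩ ≡ 𝟘
  dot-𝟎ˡ []      = refl
  dot-𝟎ˡ (a ∷ x) = trans (cong₂ _⊕_ (zeroˡ a) (dot-𝟎ˡ x)) (+-identityʳ 𝟘)

  dot-𝟎ʳ : ∀ {n} (x : Vec𝔽 n) → ⟨ x , 𝟎 n ⟩ ≡ 𝟘
  dot-𝟎ʳ []      = refl
  dot-𝟎ʳ (a ∷ x) = trans (cong₂ _⊕_ (zeroʳ a) (dot-𝟎ʳ x)) (+-identityʳ 𝟘)

  dot-⊞ʳ : ∀ {n} (x y z : Vec𝔽 n) → ⟨ x , y ⊞ z ⟩ ≡ ⟨ x , y ⟩ ⊕ ⟨ x , z ⟩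
  dot-⊞ʳ []      []      []      = sym (+-identityʳ 𝟘)
  dot-⊞ʳ (a ∷ x) (b ∷ y) (c ∷ z) = trans (cong (a ⊛ (b ⊕ c) ⊕_) (dot-⊞ʳ x y z))
    (solve 5 (λ a b c s t → a :* (b :+ c) :+ (s :+ t) := a :* b :+ s :+ (a :* c :+ t)) refl a b c ⟨ x , y ⟩ ⟨ x , z ⟩)

  dot-⊙ˡ : ∀ {n} c (x y : Vec𝔽 n) → ⟨ c ⊙ x , y ⟩ ≡ c ⊛ ⟨ x , y ⟩
  dot-⊙ˡ c []      []      = sym (zeroʳ c)
  dot-⊙ˡ c (a ∷ x) (b ∷ y) = trans (cong (c ⊛ a ⊛ b ⊕_) (dot-⊙ˡ c x y))
    (solve 4 (λ c a b s → c :* a :* b :+ c :* s := c :* (a :* b :+ s)) refl c a b ⟨ x , y ⟩)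

  dot-⊙ʳ : ∀ {n} c (x y : Vec𝔽 n) → ⟨ x , c ⊙ y ⟩ ≡ c ⊛ ⟨ x , y ⟩
  dot-⊙ʳ c []      []      = sym (zeroʳ c)
  dot-⊙ʳ c (a ∷ x) (b ∷ y) = trans (cong (a ⊛ (c ⊛ b) ⊕_) (dot-⊙ʳ c x y))
    (solve 4 (λ c a b s → a :* (c :* b) :+ c :* s := c :* (a :* b :+ s)) refl c a b ⟨ x , y ⟩)

  dot-linComb-⊥ : ∀ {n k} (x : Vec𝔽 n) (cs : Vec 𝔽 k) (ws : Vec (Vec𝔽 n) k) →
                  (∀ j → ⟨ x , lookup ws j ⟩ ≡ 𝟘) → ⟨ x , linComb p cs ws ⟩ ≡ 𝟘
  dot-linComb-⊥ x []       []       x⊥ws = dot-𝟎ʳ x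
  dot-linComb-⊥ x (c ∷ cs) (w ∷ ws) x⊥ws = begin
    ⟨ x , c ⊙ w ⊞ linComb p cs ws ⟩            ≡⟨ dot-⊞ʳ x _ _ ⟩
    ⟨ x , c ⊙ w ⟩ ⊕ ⟨ x , linComb p cs ws ⟩    ≡⟨ cong₂ _⊕_ (dot-⊙ʳ c x w) (dot-linComb-⊥ x cs ws (x⊥ws ∘ suc)) ⟩
    c ⊛ ⟨ x , w ⟩ ⊕ 𝟘                          ≡⟨ cong (λ t → c ⊛ t ⊕ 𝟘) (x⊥ws zero) ⟩
    c ⊛ 𝟘 ⊕ 𝟘                                  ≡⟨ cong (_⊕ 𝟘) (zeroʳ c) ⟩
    𝟘 ⊕ 𝟘                                      ≡⟨ +-identityʳ 𝟘 ⟩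
    𝟘                                          ∎
    where open ≡-Reasoning

  quadForm-⊙ : ∀ {n} (M : Mat p n) c (x : Vec𝔽 n) → quadForm p M (c ⊙ x) ≡ c ⊛ (c ⊛ quadForm p M x)
  quadForm-⊙ M c x = begin
    ⟨ c ⊙ x , matVec p M (c ⊙ x) ⟩      ≡⟨ cong (λ y → ⟨ c ⊙ x , y ⟩) (rows-⊙ M) ⟩
    ⟨ c ⊙ x , c ⊙ matVec p M x ⟩        ≡⟨ dot-⊙ˡ c x _ ⟩
    c ⊛ ⟨ x , c ⊙ matVec p M x ⟩        ≡⟨ cong (c ⊛_) (dot-⊙ʳ c x _) ⟩
    c ⊛ (c ⊛ quadForm p M x)           ∎
    where
    open ≡-Reasoning
    rows-⊙ : ∀ {m} (rows : Vec (Vec𝔽 _) m) →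
             Vec.map (λ row → ⟨ row , c ⊙ x ⟩) rows ≡ c ⊙ Vec.map (λ row → ⟨ row , x ⟩) rows
    rows-⊙ []           = refl
    rows-⊙ (row ∷ rows) = cong₂ _∷_ (dot-⊙ʳ c row x) (rows-⊙ rows)

  _≟V_ : ∀ {n} → DecidableEquality (Vec𝔽 n)
  _≟V_ = ≡-dec _≟F_

  𝔽ⁿ : ∀ n → List (Vec𝔽 n)
  𝔽ⁿ = allVecs p

  ∑-δ : ∀ n (w : Vec𝔽 n) (k : Vec𝔽 n → ℕ) → ∑ (𝔽ⁿ n) (λ z → if does (w ≟V z) then k z else 0) ≡ k w
  ∑-δ zero    []      k = ℕ.+-identityʳ (k [])
  ∑-δ (suc n) (b ∷ w) k = begin
    ∑ (concatMap (λ a → List.map (a ∷_) (𝔽ⁿ n)) (allFin p)) δ       ≡⟨ ∑-concatMap _ (allFin p) δ ⟩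
    ∑ (allFin p) (λ a → ∑ (List.map (a ∷_) (𝔽ⁿ n)) δ)               ≡⟨ ∑-cong (allFin p) (λ a → trans (∑-map (a ∷_) (𝔽ⁿ n) δ) (row a)) ⟩
    ∑ (allFin p) (λ a → if does (b ≟F a) then k (a ∷ w) else 0)     ≡⟨ ∑-δ-Fin p b (λ a → k (a ∷ w)) ⟩
    k (b ∷ w)                                                       ∎
    where
    open ≡-Reasoning
    δ : Vec𝔽 (suc n) → ℕ
    δ z = if does ((b ∷ w) ≟V z) then k z else 0
    row : ∀ a → ∑ (𝔽ⁿ n) (λ z → δ (a ∷ z)) ≡ (if does (b ≟F a) then k (a ∷ w) else 0)
    row a with does (b ≟F a)
    ... | true  = ∑-δ n w (λ z → k (a ∷ z))
    ... | false = ∑-zero (𝔽ⁿ n)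

  term≤∑ : ∀ n (w : Vec𝔽 n) (k : Vec𝔽 n → ℕ) → k w ≤ ∑ (𝔽ⁿ n) k
  term≤∑ n w k = subst (_≤ ∑ (𝔽ⁿ n) k) (∑-δ n w k) (∑-mono-≤ (𝔽ⁿ n) (λ z → if-then-0-≤ (does (w ≟V z))))

  ∑-∘-bijection : ∀ n (f g : Vec𝔽 n → Vec𝔽 n) → (∀ y → g (f y) ≡ y) → (∀ z → f (g z) ≡ z) →
                  ∀ k → ∑ (𝔽ⁿ n) (k ∘ f) ≡ ∑ (𝔽ⁿ n) k
  ∑-∘-bijection n f g g∘f f∘g k = begin
    ∑ (𝔽ⁿ n) (k ∘ f)                                                          ≡⟨ ∑-cong (𝔽ⁿ n) (λ y → sym (∑-δ n (f y) k)) ⟩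
    ∑ (𝔽ⁿ n) (λ y → ∑ (𝔽ⁿ n) (λ z → if does (f y ≟V z) then k z else 0))     ≡⟨ ∑-comm (𝔽ⁿ n) (𝔽ⁿ n) _ ⟩
    ∑ (𝔽ⁿ n) (λ z → ∑ (𝔽ⁿ n) (λ y → if does (f y ≟V z) then k z else 0))     ≡⟨ ∑-cong (𝔽ⁿ n) (λ z → ∑-cong (𝔽ⁿ n) (λ y →
                                                                                  cong (λ b → if b then k z else 0) (does-⇔ (fy≡z⇔gz≡y y z) (f y ≟V z) (g z ≟V y)))) ⟩
    ∑ (𝔽ⁿ n) (λ z → ∑ (𝔽ⁿ n) (λ y → if does (g z ≟V y) then k z else 0))     ≡⟨ ∑-cong (𝔽ⁿ n) (λ z → ∑-δ n (g z) (λ _ → k z)) ⟩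
    ∑ (𝔽ⁿ n) k                                                                ∎
    where
    open ≡-Reasoning
    fy≡z⇔gz≡y : ∀ y z → (f y ≡ z) ⇔ (g z ≡ y)
    fy≡z⇔gz≡y y z = mk⇔ (λ { refl → g∘f y }) (λ { refl → f∘g z })

  𝕀 : Bool → ℕ
  𝕀 b = if b then 1 else 0

  𝕀≤1 : ∀ b → 𝕀 b ≤ 1
  𝕀≤1 true  = ℕ.≤-refl
  𝕀≤1 false = z≤n

  count-∑ : ∀ {n} (P : Subset p n) → count p P ≡ ∑ (𝔽ⁿ n) (𝕀 ∘ P)
  count-∑ {n} P = go (𝔽ⁿ n)
    where
    go : ∀ xs → length (List.filter (λ x → P x Bool.≟ true) xs) ≡ ∑ xs (𝕀 ∘ P)
    go []       = refl
    go (x ∷ xs) with P x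
    ... | true  = cong suc (go xs)
    ... | false = go xs

  count-∘-bijection : ∀ n (f g : Vec𝔽 n → Vec𝔽 n) → (∀ y → g (f y) ≡ y) → (∀ z → f (g z) ≡ z) →
                      ∀ (P : Subset p n) → count p (P ∘ f) ≡ count p P
  count-∘-bijection n f g g∘f f∘g P =
    trans (count-∑ (P ∘ f)) (trans (∑-∘-bijection n f g g∘f f∘g (𝕀 ∘ P)) (sym (count-∑ P)))

  count-cong : ∀ {n} {P Q : Subset p n} → (∀ y → P y ≡ Q y) → count p P ≡ count p Q
  count-cong {n} {P} {Q} P≗Q = trans (count-∑ P) (trans (∑-cong (𝔽ⁿ n) (cong 𝕀 ∘ P≗Q)) (sym (count-∑ Q)))

  count-pos : ∀ {n} (P : Subset p n) w → P w ≡ true → 0 < count p P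
  count-pos {n} P w Pw = subst (0 <_) (sym (count-∑ P)) (subst (λ b → 𝕀 b ≤ ∑ (𝔽ⁿ n) (𝕀 ∘ P)) Pw (term≤∑ n w (𝕀 ∘ P)))

  count-∩-≤-half : ∀ n (σ : Vec𝔽 n → Vec𝔽 n) → (∀ y → σ (σ y) ≡ y) → (A S : Subset p n) →
                   (∀ y → A y ≡ true → A (σ y) ≡ false) → (∀ y → S (σ y) ≡ S y) →
                   count p (λ y → A y ∧ S y) + count p (λ y → A y ∧ S y) ≤ count p S
  count-∩-≤-half n σ σ∘σ A S A∩σA≡∅ S∘σ≡S = begin
    count p A∩S + count p A∩S                          ≡⟨ cong (count p A∩S +_) count-σ ⟩
    count p A∩S + count p (λ y → A (σ y) ∧ S y)        ≡⟨ cong₂ _+_ (count-∑ A∩S) (count-∑ (λ y → A (σ y) ∧ S y)) ⟩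
    ∑ (𝔽ⁿ n) (𝕀 ∘ A∩S) + ∑ (𝔽ⁿ n) (λ y → 𝕀 (A (σ y) ∧ S y))   ≡⟨ sym (∑-distrib-+ (𝔽ⁿ n) _ _) ⟩
    ∑ (𝔽ⁿ n) (λ y → 𝕀 (A y ∧ S y) + 𝕀 (A (σ y) ∧ S y)) ≤⟨ ∑-mono-≤ (𝔽ⁿ n) (λ y → disjoint (A y) (A (σ y)) (S y) (A∩σA≡∅ y)) ⟩
    ∑ (𝔽ⁿ n) (𝕀 ∘ S)                                   ≡⟨ sym (count-∑ S) ⟩
    count p S                                          ∎
    where
    open ℕ.≤-Reasoning
    A∩S : Subset p n
    A∩S y = A y ∧ S y
    count-σ : count p A∩S ≡ count p (λ y → A (σ y) ∧ S y)
    count-σ = trans (sym (count-∘-bijection n σ σ σ∘σ σ∘σ A∩S)) (count-cong (λ y → cong (A (σ y) ∧_) (S∘σ≡S y)))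
    disjoint : ∀ a a′ s → (a ≡ true → a′ ≡ false) → 𝕀 (a ∧ s) + 𝕀 (a′ ∧ s) ≤ 𝕀 s
    disjoint true  a′    true  a⇒¬a′ with a⇒¬a′ refl
    ... | refl = ℕ.≤-refl
    disjoint false true  true  _ = ℕ.≤-refl
    disjoint false false true  _ = z≤n
    disjoint a     a′    false _ = ℕ.≤-reflexive (cong₂ (λ u v → 𝕀 u + 𝕀 v) (∧-zeroʳ a) (∧-zeroʳ a′))

  EpsExtreme-≤-half⇒sparse : ∀ {n} m (A S : Subset p n) → 1 ≤ m → EpsExtreme p 0 m A S →
                             count p (λ y → A y ∧ S y) + count p (λ y → A y ∧ S y) ≤ count p S →
                             count p (λ y → A y ∧ S y) * suc m < count p S
  EpsExtreme-≤-half⇒sparse m A S 1≤m (inj₁ sparse) _ = subst (|A∩S| * suc m <_) (ℕ.*-identityˡ (count p S)) sparse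
    where |A∩S| = count p (λ y → A y ∧ S y)
  EpsExtreme-≤-half⇒sparse m A S 1≤m (inj₂ dense) ≤half =
    ⊥-elim (ℕ.<⇒≱ (subst ((count p S ∸ |A∩S|) * suc m <_) (ℕ.*-identityˡ (count p S)) dense)
                  (m+m≤n⇒n≤[n∸m]*suc[o] |A∩S| (count p S) m 1≤m ≤half))
    where |A∩S| = count p (λ y → A y ∧ S y)

  PairIso-refl : ∀ {n} (A : Subset p n) → PairIso p A A
  PairIso-refl {n} A = id , ((λ x y → cong (_⊞ y) (sym (⊟-identityʳ x))) , id , (λ _ → refl) , (λ _ → refl)) , (λ _ → refl)

  PairIso-sym : ∀ {n} {A B : Subset p n} → PairIso p A B → PairIso p B A
  PairIso-sym {n} {A} {B} (f , (f-affine , g , g∘f , f∘g) , f-maps) =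
    g , (g-affine , f , f∘g , g∘f) , (λ y → trans (sym (f-maps (g y))) (cong B (f∘g y)))
    where
    g-affine : ∀ u w → g (u ⊞ w) ≡ g u ⊟ g (𝟎 n) ⊞ g w
    g-affine u w = trans (cong g (sym f[t]≡u+w)) (g∘f t)
      where
      t = g u ⊟ g (𝟎 n) ⊞ g w
      f[gu]≡ : f (g u) ≡ f (g u ⊟ g (𝟎 n)) ⊟ f (𝟎 n)
      f[gu]≡ = begin
        f (g u)                                              ≡⟨ cong f (sym (⊟-⊞-cancel (g u) (g (𝟎 n)))) ⟩
        f (g u ⊟ g (𝟎 n) ⊞ g (𝟎 n))                          ≡⟨ f-affine _ _ ⟩
        f (g u ⊟ g (𝟎 n)) ⊟ f (𝟎 n) ⊞ f (g (𝟎 n))            ≡⟨ cong (f (g u ⊟ g (𝟎 n)) ⊟ f (𝟎 n) ⊞_) (f∘g (𝟎 n)) ⟩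
        f (g u ⊟ g (𝟎 n)) ⊟ f (𝟎 n) ⊞ 𝟎 n                    ≡⟨ ⊞-identityʳ _ ⟩
        f (g u ⊟ g (𝟎 n)) ⊟ f (𝟎 n)                          ∎
        where open ≡-Reasoning
      f[t]≡u+w : f t ≡ u ⊞ w
      f[t]≡u+w = begin
        f t                                      ≡⟨ f-affine _ _ ⟩
        f (g u ⊟ g (𝟎 n)) ⊟ f (𝟎 n) ⊞ f (g w)    ≡⟨ cong (_⊞ f (g w)) (sym f[gu]≡) ⟩
        f (g u) ⊞ f (g w)                        ≡⟨ cong₂ _⊞_ (f∘g u) (f∘g w) ⟩
        u ⊞ w                                    ∎
        where open ≡-Reasoning

  inH-zero : ∀ {n} u (z : Vec𝔽 n) → inH p zero (u ∷ z) ≡ (u == 𝟘)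
  inH-zero {n} u z = trans (all-allFin-suc (λ j → if ⌊ toℕ j ℕ.≤? 0 ⌋ then lookup (u ∷ z) j == 𝟘 else true))
                           (trans (cong ((u == 𝟘) ∧_) (all-true (allFin n))) (∧-identityʳ _))

  inH-suc : ∀ {n} i u (z : Vec𝔽 n) → inH p (suc i) (u ∷ z) ≡ (u == 𝟘) ∧ inH p i z
  inH-suc {n} i u z = trans (all-allFin-suc (λ j → if ⌊ toℕ j ℕ.≤? toℕ (suc i) ⌋ then lookup (u ∷ z) j == 𝟘 else true))
    (cong ((u == 𝟘) ∧_) (all-cong (λ j → cong (λ b → if b then lookup z j == 𝟘 else true)
                                          (⌊⌋-⇔ (mk⇔ s≤s⁻¹ s≤s) (suc (toℕ j) ℕ.≤? suc (toℕ i)) (toℕ j ℕ.≤? toℕ i)))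
                                (allFin n)))

  e-suc : ∀ n (i : Fin n) → e p (suc n) (suc i) ≡ 𝟘 ∷ e p n i
  e-suc n i = cong (𝟘 ∷_) (Vecₚ.tabulate-cong (λ j → cong (λ b → if b then 𝟙 else 𝟘)
                (⌊⌋-⇔ (mk⇔ suc-injective (cong suc)) (suc j ≟F suc i) (j ≟F i))))

  AGS-∷ : ∀ {n} a (y : Vec𝔽 n) → AGS p (suc n) (a ∷ y) ≡ (a == 𝟙) ∨ ((a == 𝟘) ∧ AGS p n y)
  AGS-∷ {n} a y = begin
    AGS p (suc n) (a ∷ y)                                                        ≡⟨ any-allFin-suc (λ i → inH p i ((a ∷ y) ⊟ e p (suc n) i)) ⟩
    inH p zero ((a ∷ y) ⊟ e p (suc n) zero) ∨ any (λ i → inH p (suc i) ((a ∷ y) ⊟ e p (suc n) (suc i))) (allFin n)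
        ≡⟨ cong₂ _∨_ (trans (inH-zero (a ⊖ 𝟙) (y ⊟ Vec.tail (e p (suc n) zero))) (⌊⌋-⇔ (⊖≡𝟘⇔≡ a 𝟙) _ _)) (any-cong step (allFin n)) ⟩
    (a == 𝟙) ∨ any (λ i → (a == 𝟘) ∧ inH p i (y ⊟ e p n i)) (allFin n)        ≡⟨ cong ((a == 𝟙) ∨_) (any-∧ˡ (a == 𝟘) _ (allFin n)) ⟩
    (a == 𝟙) ∨ ((a == 𝟘) ∧ AGS p n y)                                         ∎
    where
    open ≡-Reasoning
    step : ∀ i → inH p (suc i) ((a ∷ y) ⊟ e p (suc n) (suc i)) ≡ (a == 𝟘) ∧ inH p i (y ⊟ e p n i)
    step i = begin
      inH p (suc i) ((a ∷ y) ⊟ e p (suc n) (suc i))   ≡⟨ cong (λ v → inH p (suc i) ((a ∷ y) ⊟ v)) (e-suc n i) ⟩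
      inH p (suc i) ((a ⊖ 𝟘) ∷ (y ⊟ e p n i))         ≡⟨ inH-suc i (a ⊖ 𝟘) _ ⟩
      (a ⊖ 𝟘 == 𝟘) ∧ inH p i (y ⊟ e p n i)            ≡⟨ cong (λ b → (b == 𝟘) ∧ _) (⊖-identityʳ a) ⟩
      (a == 𝟘) ∧ inH p i (y ⊟ e p n i)                ∎

  AGS-𝟙∷ : ∀ {n} (y : Vec𝔽 n) → AGS p (suc n) (𝟙 ∷ y) ≡ true
  AGS-𝟙∷ y = trans (AGS-∷ 𝟙 y) (cong (_∨ ((𝟙 == 𝟘) ∧ AGS p _ y)) (==-true 𝟙 𝟙 refl))

  AGS-∷-other : ∀ {n} a (y : Vec𝔽 n) → a ≢ 𝟙 → a ≢ 𝟘 → AGS p (suc n) (a ∷ y) ≡ false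
  AGS-∷-other a y a≢𝟙 a≢𝟘 =
    trans (AGS-∷ a y) (cong₂ (λ b₁ b₂ → b₁ ∨ (b₂ ∧ AGS p _ y)) (==-false a 𝟙 a≢𝟙) (==-false a 𝟘 a≢𝟘))

  allTrue-zipWith-cong : ∀ {A B C : Set} {k} (f : A → B → Bool) (g : A → C → Bool) (xs : Vec A k) ys zs →
                         (∀ i → f (lookup xs i) (lookup ys i) ≡ g (lookup xs i) (lookup zs i)) →
                         allTrue p (zipWith f xs ys) ≡ allTrue p (zipWith g xs zs)
  allTrue-zipWith-cong f g []       []       []       f≗g = refl
  allTrue-zipWith-cong f g (x ∷ xs) (y ∷ ys) (z ∷ zs) f≗g = cong₂ _∧_ (f≗g zero) (allTrue-zipWith-cong f g xs ys zs (f≗g ∘ suc))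

  allTrue-zipWith : ∀ {A B : Set} {k} (f : A → B → Bool) (xs : Vec A k) ys →
                    (∀ i → f (lookup xs i) (lookup ys i) ≡ true) → allTrue p (zipWith f xs ys) ≡ true
  allTrue-zipWith f []       []       f≡true = refl
  allTrue-zipWith f (x ∷ xs) (y ∷ ys) f≡true = cong₂ _∧_ (f≡true zero) (allTrue-zipWith f xs ys (f≡true ∘ suc))

module PrimeField (p : ℕ) .{{_ : NonZero p}} (p-prime : Prime p) where
  open ZMod p

  𝟙≢𝟘 : 𝟙 ≢ 𝟘
  𝟙≢𝟘 𝟙≡𝟘 = 1≢0 (begin
    1          ≡⟨ sym (m<n⇒m%n≡m (nonTrivial⇒n>1 p {{prime⇒nonTrivial p-prime}})) ⟩
    1 % p      ≡⟨ sym (toℕ-ι 1) ⟩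
    toℕ 𝟙      ≡⟨ cong toℕ 𝟙≡𝟘 ⟩
    toℕ 𝟘      ≡⟨ toℕ-𝟘 ⟩
    0          ∎)
    where
    open ≡-Reasoning
    1≢0 : 1 ≢ 0
    1≢0 ()

  ⊛-inverseˡ : ∀ a → a ≢ 𝟘 → ∃ λ b → b ⊛ a ≡ 𝟙
  ⊛-inverseˡ a a≢𝟘 with coprime-Bézout (prime⇒coprime p-prime (toℕ<n a))
    where
    instance
      toℕa≢0 : NonZero (toℕ a)
      toℕa≢0 = ≢-nonZero (λ eq → a≢𝟘 (toℕ-injective (trans eq (sym toℕ-𝟘))))
  ... | Bézout.-+ x y 1+xp≡ya = ι y , sym (trans (sym (ι[m+k*p]≡ι[m] 1 x)) (trans (cong ι 1+xp≡ya) (ι-*-toℕ y a)))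
  ... | Bézout.+- x y 1+ya≡xp = ⊝ ι y , (begin
    ⊝ ι y ⊛ a        ≡⟨ sym (-‿distribˡ-* (ι y) a) ⟩
    ⊝ (ι y ⊛ a)      ≡⟨ cong ⊝_ (inverseʳ-unique 𝟙 (ι y ⊛ a) 𝟙+ya≡𝟘) ⟩
    ⊝ ⊝ 𝟙            ≡⟨ ⁻¹-involutive 𝟙 ⟩
    𝟙                ∎)
    where
    open ≡-Reasoning
    𝟙+ya≡𝟘 : 𝟙 ⊕ ι y ⊛ a ≡ 𝟘
    𝟙+ya≡𝟘 = begin
      𝟙 ⊕ ι y ⊛ a        ≡⟨ cong (𝟙 ⊕_) (sym (ι-*-toℕ y a)) ⟩
      ι 1 ⊕ ι (y * toℕ a) ≡⟨ sym (ι-+ 1 _) ⟩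
      ι (1 + y * toℕ a)   ≡⟨ cong ι 1+ya≡xp ⟩
      ι (0 + x * p)       ≡⟨ ι[m+k*p]≡ι[m] 0 x ⟩
      𝟘                   ∎

  ⊛-cancelˡ : ∀ c → c ≢ 𝟘 → ∀ a b → c ⊛ a ≡ c ⊛ b → a ≡ b
  ⊛-cancelˡ c c≢𝟘 a b ca≡cb with ⊛-inverseˡ c c≢𝟘
  ... | c⁻¹ , c⁻¹c≡𝟙 = begin
    a              ≡⟨ sym (⊛-identityˡ a) ⟩
    𝟙 ⊛ a          ≡⟨ cong (_⊛ a) (sym c⁻¹c≡𝟙) ⟩
    c⁻¹ ⊛ c ⊛ a    ≡⟨ ⊛-assoc c⁻¹ c a ⟩
    c⁻¹ ⊛ (c ⊛ a)  ≡⟨ cong (c⁻¹ ⊛_) ca≡cb ⟩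
    c⁻¹ ⊛ (c ⊛ b)  ≡⟨ sym (⊛-assoc c⁻¹ c b) ⟩
    c⁻¹ ⊛ c ⊛ b    ≡⟨ cong (_⊛ b) c⁻¹c≡𝟙 ⟩
    𝟙 ⊛ b          ≡⟨ ⊛-identityˡ b ⟩
    b              ∎
    where open ≡-Reasoning

  ⊙-invertible : ∀ c → c ≢ 𝟘 →
                 ∃ λ c⁻¹ → (∀ {n} (y : Vec𝔽 n) → c⁻¹ ⊙ c ⊙ y ≡ y) × (∀ {n} (y : Vec𝔽 n) → c ⊙ c⁻¹ ⊙ y ≡ y)
  ⊙-invertible c c≢𝟘 with ⊛-inverseˡ c c≢𝟘
  ... | c⁻¹ , c⁻¹c≡𝟙 = c⁻¹ , scale-by-𝟙 c⁻¹ c c⁻¹c≡𝟙 , scale-by-𝟙 c c⁻¹ (trans (⊛-comm c c⁻¹) c⁻¹c≡𝟙)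
    where
    scale-by-𝟙 : ∀ a b → a ⊛ b ≡ 𝟙 → ∀ {n} (y : Vec𝔽 n) → a ⊙ b ⊙ y ≡ y
    scale-by-𝟙 a b ab≡𝟙 y = trans (⊙-assoc a b y) (trans (cong (_⊙ y) ab≡𝟙) (⊙-identityˡ y))

  dot-eliminate : ∀ {n} c (w y : Vec𝔽 n) b (u : Vec𝔽 n) →
                  ⟨ ⊝ (c ⊛ ⟨ y , w ⟩) ∷ y , b ∷ u ⟩ ≡ ⟨ y , u ⊞ ⊝ (b ⊛ c) ⊙ w ⟩
  dot-eliminate c w y b u = begin
    ⊝ (c ⊛ s) ⊛ b ⊕ ⟨ y , u ⟩             ≡⟨ cong (_⊕ ⟨ y , u ⟩) (sym (-‿distribˡ-* (c ⊛ s) b)) ⟩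
    ⊝ (c ⊛ s ⊛ b) ⊕ ⟨ y , u ⟩             ≡⟨ cong (λ t → ⊝ t ⊕ ⟨ y , u ⟩) (solve 3 (λ c s b → c :* s :* b := b :* c :* s) refl c s b) ⟩
    ⊝ (b ⊛ c ⊛ s) ⊕ ⟨ y , u ⟩             ≡⟨ cong (_⊕ ⟨ y , u ⟩) (-‿distribˡ-* (b ⊛ c) s) ⟩
    ⊝ (b ⊛ c) ⊛ s ⊕ ⟨ y , u ⟩             ≡⟨ ⊕-comm (⊝ (b ⊛ c) ⊛ s) ⟨ y , u ⟩ ⟩
    ⟨ y , u ⟩ ⊕ ⊝ (b ⊛ c) ⊛ s             ≡⟨ cong (⟨ y , u ⟩ ⊕_) (sym (dot-⊙ʳ (⊝ (b ⊛ c)) y w)) ⟩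
    ⟨ y , u ⟩ ⊕ ⟨ y , ⊝ (b ⊛ c) ⊙ w ⟩     ≡⟨ sym (dot-⊞ʳ y u _) ⟩
    ⟨ y , u ⊞ ⊝ (b ⊛ c) ⊙ w ⟩             ∎
    where
    open ≡-Reasoning
    s = ⟨ y , w ⟩

  -- Gaussian elimination on the first coordinate: a pivot a ∷ w with a ≢ 𝟘 clears the first
  -- coordinate of the other vectors, and a solution y of the smaller system lifts to
  -- x = -(a⁻¹⟨y,w⟩) ∷ y by dot-eliminate.
  ∃-nonzero-orthogonal : ∀ n (ws : List (Vec𝔽 n)) → length ws < n →
                         ∃ λ x → x ≢ 𝟎 n × All (λ w → ⟨ x , w ⟩ ≡ 𝟘) ws
  ∃-nonzero-orthogonal (suc n) ws |ws|<n with All.all? (λ w → head w ≟F 𝟘) ws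
  ... | yes heads≡𝟘 = (𝟙 ∷ 𝟎 n) , (𝟙≢𝟘 ∘ ∷-injectiveˡ) , All.map (λ {w} → e₀-⊥ {w}) heads≡𝟘
    where
    e₀-⊥ : ∀ {w} → head w ≡ 𝟘 → ⟨ 𝟙 ∷ 𝟎 n , w ⟩ ≡ 𝟘
    e₀-⊥ {b ∷ w} b≡𝟘 = trans (cong₂ _⊕_ (trans (cong (𝟙 ⊛_) b≡𝟘) (zeroʳ 𝟙)) (dot-𝟎ˡ w)) (+-identityʳ 𝟘)
  ... | no ¬heads≡𝟘 with find (Allₚ.¬All⇒Any¬ (λ w → head w ≟F 𝟘) ws ¬heads≡𝟘)
  ... | a ∷ w , w∈ws , a≢𝟘 with ∈-∃++ w∈ws | ⊛-inverseˡ a a≢𝟘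
  ... | pre , post , refl | a⁻¹ , a⁻¹a≡𝟙 = x , x≢𝟎 , Allₚ.++⁺ (Allₚ.++⁻ˡ pre x⊥rest) (x⊥pivot All.∷ Allₚ.++⁻ʳ pre x⊥rest)
    where
    eliminate : Vec𝔽 (suc n) → Vec𝔽 n
    eliminate (b ∷ u) = u ⊞ ⊝ (b ⊛ a⁻¹) ⊙ w
    rest = pre ++ post
    |rest|<n : length (List.map eliminate rest) < n
    |rest|<n = begin-strict
      length (List.map eliminate rest)   ≡⟨ length-map eliminate rest ⟩
      length rest                        <⟨ s≤s⁻¹ (subst (_< suc n) (length-++-sucʳ pre (a ∷ w) post) |ws|<n) ⟩
      n                                  ∎
      where open ℕ.≤-Reasoning
    IH = ∃-nonzero-orthogonal n (List.map eliminate rest) |rest|<n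
    y = proj₁ IH
    x = ⊝ (a⁻¹ ⊛ ⟨ y , w ⟩) ∷ y
    x≢𝟎 : x ≢ 𝟎 (suc n)
    x≢𝟎 = proj₁ (proj₂ IH) ∘ ∷-injectiveʳ
    x⊥rest : All (λ u → ⟨ x , u ⟩ ≡ 𝟘) rest
    x⊥rest = All.map (λ { {b ∷ u} y⊥ → trans (dot-eliminate a⁻¹ w y b u) y⊥ }) (Allₚ.map⁻ (proj₂ (proj₂ IH)))
    x⊥pivot : ⟨ x , a ∷ w ⟩ ≡ 𝟘
    x⊥pivot = begin
      ⟨ x , a ∷ w ⟩                              ≡⟨ dot-eliminate a⁻¹ w y a w ⟩
      ⟨ y , w ⊞ ⊝ (a ⊛ a⁻¹) ⊙ w ⟩                ≡⟨ cong (λ c → ⟨ y , w ⊞ ⊝ c ⊙ w ⟩) (trans (⊛-comm a a⁻¹) a⁻¹a≡𝟙) ⟩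
      ⟨ y , w ⊞ ⊝ 𝟙 ⊙ w ⟩                        ≡⟨ dot-⊞ʳ y w _ ⟩
      ⟨ y , w ⟩ ⊕ ⟨ y , ⊝ 𝟙 ⊙ w ⟩                ≡⟨ cong (⟨ y , w ⟩ ⊕_) (trans (dot-⊙ʳ (⊝ 𝟙) y w) (-1*x≈-x ⟨ y , w ⟩)) ⟩
      ⟨ y , w ⟩ ⊕ ⊝ ⟨ y , w ⟩                    ≡⟨ ⊝-inverseʳ ⟨ y , w ⟩ ⟩
      𝟘                                          ∎
      where open ≡-Reasoning

  AGS-𝟘∷ : ∀ {n} (y : Vec𝔽 n) → AGS p (suc n) (𝟘 ∷ y) ≡ AGS p n y
  AGS-𝟘∷ y =
    trans (AGS-∷ 𝟘 y) (cong₂ (λ b₁ b₂ → b₁ ∨ (b₂ ∧ AGS p _ y)) (==-false 𝟘 𝟙 (𝟙≢𝟘 ∘ sym)) (==-true 𝟘 𝟘 refl))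

  AGS-𝟎 : ∀ n → AGS p n (𝟎 n) ≡ false
  AGS-𝟎 zero    = refl
  AGS-𝟎 (suc n) = trans (AGS-𝟘∷ (𝟎 n)) (AGS-𝟎 n)

  AGS-meets-every-line : ∀ {n} (y : Vec𝔽 n) → y ≢ 𝟎 n → ∃ λ c → c ≢ 𝟘 × AGS p n (c ⊙ y) ≡ true
  AGS-meets-every-line []      y≢𝟎 = ⊥-elim (y≢𝟎 refl)
  AGS-meets-every-line (a ∷ y) y≢𝟎 with a ≟F 𝟘
  ... | no a≢𝟘 with ⊛-inverseˡ a a≢𝟘
  ...   | a⁻¹ , a⁻¹a≡𝟙 = a⁻¹ , a⁻¹≢𝟘 , trans (cong (λ h → AGS p _ (h ∷ a⁻¹ ⊙ y)) a⁻¹a≡𝟙) (AGS-𝟙∷ (a⁻¹ ⊙ y))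
    where
    a⁻¹≢𝟘 : a⁻¹ ≢ 𝟘
    a⁻¹≢𝟘 a⁻¹≡𝟘 = 𝟙≢𝟘 (trans (sym a⁻¹a≡𝟙) (trans (cong (_⊛ a) a⁻¹≡𝟘) (zeroˡ a)))
  AGS-meets-every-line (a ∷ y) y≢𝟎 | yes refl with AGS-meets-every-line y (y≢𝟎 ∘ cong (𝟘 ∷_))
  ... | c , c≢𝟘 , hit = c , c≢𝟘 , trans (cong (λ h → AGS p _ (h ∷ c ⊙ y)) (zeroʳ c)) (trans (AGS-𝟘∷ (c ⊙ y)) hit)

  HasDimSpan⇒∃-nonzero-⊥ : ∀ {n ℓ d} (ws : Vec (Vec𝔽 n) ℓ) → HasDimSpan p ws d → d < n →
                           ∃ λ x → x ≢ 𝟎 n × (∀ i → ⟨ x , lookup ws i ⟩ ≡ 𝟘)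
  HasDimSpan⇒∃-nonzero-⊥ {n} ws (idx , _ , spanned) d<n = x , x≢𝟎 , x⊥ws
    where
    basis = Vec.map (lookup ws) idx
    orthogonal = ∃-nonzero-orthogonal n (Vec.toList basis) (subst (_< n) (sym (Vecₚ.length-toList basis)) d<n)
    x = proj₁ orthogonal
    x≢𝟎 = proj₁ (proj₂ orthogonal)
    x⊥ws : ∀ i → ⟨ x , lookup ws i ⟩ ≡ 𝟘
    x⊥ws i with spanned i
    ... | cs , basis·cs≡wsᵢ = subst (λ w → ⟨ x , w ⟩ ≡ 𝟘) basis·cs≡wsᵢ
                                   (dot-linComb-⊥ x cs basis (VecAllₚ.lookup⁺ (VecAllₚ.toList⁻ (proj₂ (proj₂ orthogonal)))))

  ⊛-cancelˡ-⇔ : ∀ c → c ≢ 𝟘 → ∀ a b → (c ⊛ a ≡ c ⊛ b) ⇔ (a ≡ b)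
  ⊛-cancelˡ-⇔ c c≢𝟘 a b = mk⇔ (⊛-cancelˡ c c≢𝟘 a b) (cong (c ⊛_))

  atom-⊙ : ∀ {n} (Φ : QuadFactor p n) c → c ≢ 𝟘 → (s s′ : Vec 𝔽 (q Φ)) → (∀ j → lookup s′ j ≡ c ⊛ c ⊛ lookup s j) →
           ∀ y → atom p Φ (𝟎 (ℓ Φ)) s′ (c ⊙ y) ≡ atom p Φ (𝟎 (ℓ Φ)) s y
  atom-⊙ Φ c c≢𝟘 s s′ s′≡c²s y = cong₂ _∧_
    (allTrue-zipWith-cong _ _ (vs Φ) (𝟎 (ℓ Φ)) (𝟎 (ℓ Φ))
                          (λ i → linear (lookup (vs Φ) i) (lookup (𝟎 (ℓ Φ)) i) (Vecₚ.lookup-replicate i 𝟘)))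
    (allTrue-zipWith-cong _ _ (Ms Φ) s′ s (λ j → quadratic (lookup (Ms Φ) j) (lookup s j) (lookup s′ j) (s′≡c²s j)))
    where
    linear : ∀ v r → r ≡ 𝟘 → (⟨ c ⊙ y , v ⟩ == r) ≡ (⟨ y , v ⟩ == r)
    linear v r refl = begin
      (⟨ c ⊙ y , v ⟩ == 𝟘)        ≡⟨ cong₂ _==_ (dot-⊙ˡ c y v) (sym (zeroʳ c)) ⟩
      (c ⊛ ⟨ y , v ⟩ == c ⊛ 𝟘)    ≡⟨ ⌊⌋-⇔ (⊛-cancelˡ-⇔ c c≢𝟘 _ _) _ _ ⟩
      (⟨ y , v ⟩ == 𝟘)            ∎
      where open ≡-Reasoning
    quadratic : ∀ M t t′ → t′ ≡ c ⊛ c ⊛ t → (quadForm p M (c ⊙ y) == t′) ≡ (quadForm p M y == t)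
    quadratic M t t′ refl = begin
      (quadForm p M (c ⊙ y) == c ⊛ c ⊛ t)               ≡⟨ cong₂ _==_ (quadForm-⊙ M c y) (⊛-assoc c c t) ⟩
      (c ⊛ (c ⊛ quadForm p M y) == c ⊛ (c ⊛ t))         ≡⟨ ⌊⌋-⇔ (⊛-cancelˡ-⇔ c c≢𝟘 _ _) _ _ ⟩
      (c ⊛ quadForm p M y == c ⊛ t)                     ≡⟨ ⌊⌋-⇔ (⊛-cancelˡ-⇔ c c≢𝟘 _ _) _ _ ⟩
      (quadForm p M y == t)                             ∎
      where open ≡-Reasoning

module OddPrimeField (p : ℕ) .{{_ : NonZero p}} (p-prime : Prime p) (2<p : 2 < p) where
  open Sums
  open ZMod p
  open PrimeField p p-prime

  ⊝𝟙≢𝟘 : ⊝ 𝟙 ≢ 𝟘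
  ⊝𝟙≢𝟘 ⊝𝟙≡𝟘 = 𝟙≢𝟘 (trans (sym (⁻¹-involutive 𝟙)) (trans (cong ⊝_ ⊝𝟙≡𝟘) ε⁻¹≈ε))

  ⊝𝟙≢𝟙 : ⊝ 𝟙 ≢ 𝟙
  ⊝𝟙≢𝟙 ⊝𝟙≡𝟙 = 2≢0 (begin
    2                 ≡⟨ sym (m<n⇒m%n≡m 2<p) ⟩
    2 % p             ≡⟨ sym (toℕ-ι 2) ⟩
    toℕ (ι (1 + 1))   ≡⟨ cong toℕ (ι-+ 1 1) ⟩
    toℕ (𝟙 ⊕ 𝟙)       ≡⟨ cong (λ a → toℕ (𝟙 ⊕ a)) (sym ⊝𝟙≡𝟙) ⟩
    toℕ (𝟙 ⊕ ⊝ 𝟙)     ≡⟨ cong toℕ (⊝-inverseʳ 𝟙) ⟩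
    toℕ 𝟘             ≡⟨ toℕ-𝟘 ⟩
    0                 ∎)
    where
    open ≡-Reasoning
    2≢0 : 2 ≢ 0
    2≢0 ()

  ⊝𝟙⊛⊝𝟙 : ⊝ 𝟙 ⊛ ⊝ 𝟙 ≡ 𝟙
  ⊝𝟙⊛⊝𝟙 = trans (-1*x≈-x (⊝ 𝟙)) (⁻¹-involutive 𝟙)

  ⊝𝟙⊙⊝𝟙⊙ : ∀ {n} (y : Vec𝔽 n) → ⊝ 𝟙 ⊙ ⊝ 𝟙 ⊙ y ≡ y
  ⊝𝟙⊙⊝𝟙⊙ y = trans (⊙-assoc (⊝ 𝟙) (⊝ 𝟙) y) (trans (cong (_⊙ y) ⊝𝟙⊛⊝𝟙) (⊙-identityˡ y))

  AGS-disjoint-⊝AGS : ∀ {n} (y : Vec𝔽 n) → AGS p n y ≡ true → AGS p n (⊝ 𝟙 ⊙ y) ≡ false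
  AGS-disjoint-⊝AGS {suc n} (a ∷ y) y∈A with a ≟F 𝟙 | a ≟F 𝟘
  ... | yes refl | _        = AGS-∷-other (⊝ 𝟙 ⊛ 𝟙) (⊝ 𝟙 ⊙ y) (⊝𝟙≢𝟙 ∘ trans (sym (*-identityʳ (⊝ 𝟙))))
                                                          (⊝𝟙≢𝟘 ∘ trans (sym (*-identityʳ (⊝ 𝟙))))
  ... | no _     | yes refl = trans (cong (λ h → AGS p _ (h ∷ ⊝ 𝟙 ⊙ y)) (zeroʳ (⊝ 𝟙)))
                                    (trans (AGS-𝟘∷ (⊝ 𝟙 ⊙ y)) (AGS-disjoint-⊝AGS y (trans (sym (AGS-𝟘∷ y)) y∈A)))
  ... | no a≢𝟙   | no a≢𝟘   = ⊥-elim (false≢true (trans (sym (AGS-∷-other a y a≢𝟙 a≢𝟘)) y∈A))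
    where
    false≢true : false ≢ true
    false≢true ()

  module _ {n} (Φ : QuadFactor p n) (x : Vec𝔽 n) (x≢𝟎 : x ≢ 𝟎 n) (x⊥vs : ∀ i → ⟨ x , lookup (vs Φ) i ⟩ ≡ 𝟘) where

    private
      S : Vec 𝔽 (q Φ)
      S = Vec.map (λ M → quadForm p M x) (Ms Φ)

      B : Subset p n
      B = atom p Φ (𝟎 (ℓ Φ)) S

      -- the atom of c ⊙ x, which for c ≢ 𝟘 is the image of B under y ↦ c ⊙ y
      dilate : 𝔽 → Subset p n
      dilate c = atom p Φ (𝟎 (ℓ Φ)) (Vec.map ((c ⊛ c) ⊛_) S)

      A : Subset p n
      A = AGS p n

      hits : 𝔽 → ℕ
      hits c = count p (λ y → A (c ⊙ y) ∧ B y)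

      x∈B : B x ≡ true
      x∈B = cong₂ _∧_
        (allTrue-zipWith _ (vs Φ) (𝟎 (ℓ Φ)) (λ i → ==-true _ _ (trans (x⊥vs i) (sym (Vecₚ.lookup-replicate i 𝟘)))))
        (allTrue-zipWith _ (Ms Φ) S (λ j → ==-true _ _ (sym (Vecₚ.lookup-map j (λ M → quadForm p M x) (Ms Φ)))))

      dilate-⊙ : ∀ c → c ≢ 𝟘 → ∀ y → dilate c (c ⊙ y) ≡ B y
      dilate-⊙ c c≢𝟘 = atom-⊙ Φ c c≢𝟘 S _ (λ j → Vecₚ.lookup-map j ((c ⊛ c) ⊛_) S)

      dilate-⊝ : ∀ c y → dilate c (⊝ 𝟙 ⊙ y) ≡ dilate c y
      dilate-⊝ c = atom-⊙ Φ (⊝ 𝟙) ⊝𝟙≢𝟘 s s (λ j → sym (trans (cong (_⊛ lookup s j) ⊝𝟙⊛⊝𝟙) (⊛-identityˡ (lookup s j))))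
        where s = Vec.map ((c ⊛ c) ⊛_) S

      module _ (c : 𝔽) (c≢𝟘 : c ≢ 𝟘) where
        private
          c⁻¹ = proj₁ (⊙-invertible c c≢𝟘)
          c⁻¹c = proj₁ (proj₂ (⊙-invertible c c≢𝟘))
          cc⁻¹ = proj₂ (proj₂ (⊙-invertible c c≢𝟘))

        count-dilate : count p (dilate c) ≡ count p B
        count-dilate = trans (sym (count-∘-bijection n (c ⊙_) (c⁻¹ ⊙_) c⁻¹c cc⁻¹ (dilate c))) (count-cong (dilate-⊙ c c≢𝟘))

        count-A∩dilate : count p (λ y → A y ∧ dilate c y) ≡ hits c
        count-A∩dilate = trans (sym (count-∘-bijection n (c ⊙_) (c⁻¹ ⊙_) c⁻¹c cc⁻¹ (λ y → A y ∧ dilate c y)))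
                               (count-cong (λ y → cong (A (c ⊙ y) ∧_) (dilate-⊙ c c≢𝟘 y)))

      hits-𝟘 : hits 𝟘 ≡ 0
      hits-𝟘 = trans (count-cong (λ y → trans (cong (λ v → A v ∧ B y) (⊙-zeroˡ y)) (cong (_∧ B y) (AGS-𝟎 n))))
                     (trans (count-∑ {n} (λ _ → false)) (∑-zero (𝔽ⁿ n)))

      H : ℕ
      H = ∑ (allFin p) hits

      module _ (extreme : ∀ r s → 0 < count p (atom p Φ r s) → EpsExtreme p 0 (2 * p) A (atom p Φ r s)) where

        hits-sparse : ∀ c → hits c * suc (2 * p) ≤ count p B
        hits-sparse c with c ≟F 𝟘
        ... | yes refl = subst (λ h → h * suc (2 * p) ≤ count p B) (sym hits-𝟘) z≤n
        ... | no c≢𝟘   = subst₂ (λ h N → h * suc (2 * p) ≤ N) (count-A∩dilate c c≢𝟘) (count-dilate c c≢𝟘) (ℕ.<⇒≤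
            (EpsExtreme-≤-half⇒sparse (2 * p) A (dilate c) 1≤2p
              (extreme (𝟎 (ℓ Φ)) _ (count-pos (dilate c) (c ⊙ x) (trans (dilate-⊙ c c≢𝟘 x) x∈B)))
              (count-∩-≤-half n (⊝ 𝟙 ⊙_) ⊝𝟙⊙⊝𝟙⊙ A (dilate c) AGS-disjoint-⊝AGS (dilate-⊝ c))))
          where
          1≤2p : 1 ≤ 2 * p
          1≤2p = ℕ.≤-trans (>-nonZero⁻¹ p) (ℕ.m≤m+n p (p + 0))

        H-sparse : H * suc (2 * p) ≤ p * count p B
        H-sparse = begin
          H * suc (2 * p)                                ≡⟨ sym (∑-distribʳ-* (allFin p) hits _) ⟩
          ∑ (allFin p) (λ c → hits c * suc (2 * p))      ≤⟨ ∑-mono-≤ (allFin p) hits-sparse ⟩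
          ∑ (allFin p) (λ _ → count p B)                 ≡⟨ ∑-const (allFin p) (count p B) ⟩
          length (allFin p) * count p B                  ≡⟨ cong (_* count p B) (length-tabulate {n = p} id) ⟩
          p * count p B                                  ∎
          where open ℕ.≤-Reasoning

      H≥1 : 1 ≤ H
      H≥1 with AGS-meets-every-line x x≢𝟎
      ... | c , _ , cx∈A = ℕ.≤-trans (count-pos (λ y → A (c ⊙ y) ∧ B y) x (cong₂ _∧_ cx∈A x∈B)) (term≤∑-allFin p c hits)

      B≤H+1 : count p B ≤ H + 1
      B≤H+1 = begin
        count p B                                                                  ≡⟨ count-∑ B ⟩
        ∑ (𝔽ⁿ n) (𝕀 ∘ B)                                                           ≤⟨ ∑-mono-≤ (𝔽ⁿ n) covered ⟩
        ∑ (𝔽ⁿ n) (λ y → ∑ (allFin p) (λ c → 𝕀 (A (c ⊙ y) ∧ B y)) + δ𝟎 y)            ≡⟨ ∑-distrib-+ (𝔽ⁿ n) _ δ𝟎 ⟩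
        ∑ (𝔽ⁿ n) (λ y → ∑ (allFin p) (λ c → 𝕀 (A (c ⊙ y) ∧ B y))) + ∑ (𝔽ⁿ n) δ𝟎   ≡⟨ cong₂ _+_ (∑-comm (𝔽ⁿ n) (allFin p) _) (∑-δ n (𝟎 n) (λ _ → 1)) ⟩
        ∑ (allFin p) (λ c → ∑ (𝔽ⁿ n) (λ y → 𝕀 (A (c ⊙ y) ∧ B y))) + 1             ≡⟨ cong (_+ 1) (∑-cong (allFin p) (λ c → sym (count-∑ {n} (λ y → A (c ⊙ y) ∧ B y)))) ⟩
        H + 1                                                                      ∎
        where
        open ℕ.≤-Reasoning
        δ𝟎 : Vec𝔽 n → ℕ
        δ𝟎 y = if does (𝟎 n ≟V y) then 1 else 0
        covered : ∀ y → 𝕀 (B y) ≤ ∑ (allFin p) (λ c → 𝕀 (A (c ⊙ y) ∧ B y)) + δ𝟎 y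
        covered y with 𝟎 n ≟V y
        ... | yes refl = ℕ.≤-trans (𝕀≤1 (B (𝟎 n))) (ℕ.m≤n+m 1 _)
        ... | no y≢𝟎   with AGS-meets-every-line y (y≢𝟎 ∘ sym)
        ...   | c , _ , cy∈A = ℕ.≤-trans (ℕ.≤-reflexive (cong (λ u → 𝕀 (u ∧ B y)) (sym cy∈A)))
                                        (ℕ.≤-trans (term≤∑-allFin p c (λ c → 𝕀 (A (c ⊙ y) ∧ B y))) (ℕ.m≤m+n _ _))

    AGS-not-extreme-on-atoms : ¬ (∀ r s → 0 < count p (atom p Φ r s) → EpsExtreme p 0 (2 * p) A (atom p Φ r s))
    AGS-not-extreme-on-atoms extreme = ℕ.<⇒≱ (0<m≤n+n⇒o*m<n*suc[2o] (count p B) H p (count-pos B x x∈B) B≤H+H) (H-sparse extreme)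
      where
      B≤H+H : count p B ≤ H + H
      B≤H+H = ℕ.≤-trans B≤H+1 (ℕ.+-monoʳ-≤ H H≥1)

  PGS-in-every-dimension : (N : ℕ) → ∃ λ n → N ≤ n × ∃ λ A → PGS p n A
  PGS-in-every-dimension N = suc N , ℕ.n≤1+n N , AGS p (suc N) , s≤s z≤n , PairIso-refl (AGS p (suc N))

  PGS-avoids-quadratically-atomic : (H : Class p) → IsEpGP p H → IsQuadAtomic p H →
                                    ∃ λ N → ∀ n → N ≤ n → ∀ A → PGS p n A → ¬ H n A
  -- ε = 1/(2p+1).
  PGS-avoids-quadratically-atomic H H-closed H-atomic with H-atomic 0 (2 * p) suc (z<s , λ k → ℕ.n<1+n (suc k))
  ... | D , N₀ , factor = N₀ + suc D , avoid
    where
    avoid : ∀ n → N₀ + suc D ≤ n → ∀ A → PGS p n A → ¬ H n A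
    avoid n N≤n A (_ , AGS≅A) H[A] with factor n (ℕ.m+n≤o⇒m≤o N₀ N≤n) (AGS p n) (H-closed n A (AGS p n) (PairIso-sym AGS≅A) H[A])
    ... | Φ , d , dim , d+q≤D , _ , extreme with HasDimSpan⇒∃-nonzero-⊥ (vs Φ) dim d<n
      where
      d<n : d < n
      d<n = ℕ.≤-trans (s≤s (ℕ.≤-trans (ℕ.m≤m+n d (q Φ)) d+q≤D)) (ℕ.m+n≤o⇒n≤o N₀ N≤n)
    ... | x , x≢𝟎 , x⊥vs = AGS-not-extreme-on-atoms Φ x x≢𝟎 x⊥vs extreme

proposition1p23 : (p : ℕ) (pp : Prime p) → 3 ≤ p → IsObstructionToQA p {{prime⇒nonZero pp}} (PGS p {{prime⇒nonZero pp}})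
proposition1p23 p pp 3≤p = PGS-in-every-dimension , PGS-avoids-quadratically-atomic
  where open OddPrimeField p {{prime⇒nonZero pp}} pp 3≤p
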